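{- For all integers $n,m\ge 0$, $$\sum_{k=0}^{n}(-1)^kq^{\binom{k}{2}}\begin{bmatrix} n\\ k\end{bmatrix}\prod_{j=n+m+1-k}^{n+m}(1+q^j)\;U_{2n+m-1-k}(1,s,q)=q^{n^2-n+mn}s^nU_{m-1}(1,s,q).$$
   Context: Let $q$ be a real number with $q\neq -1$. Let $[m]=1+q+\dots+q^{m-1}$, $[m]!=[1]\cdots[m]$, $\begin{bmatrix} m\\ j\end{bmatrix}=\frac{[m]!}{[j]![m-j]!}$. $U_{ -1}(x,s,q)=0$, $U_0(x,s,q)=1$, $U_n(x,s,q)=(1+q^{n})xU_{n-1}(x,s,q)+q^{n-1}sU_{n-2}(x,s,q)$ for $n\ge 1$; $U_n(1,s,q)$ is its value at $x=1$. Empty products equal $1$. -}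

module Defs where

open import Level using (Level)
open import Data.Nat as ℕ using (ℕ; zero; suc; _∸_)
open import Algebra.Bundles using (CommutativeRing)

-- All q-notions are defined over an arbitrary commutative ring R
-- (the paper works over the reals ℝ, which is one such ring).
module Q {c ℓ : Level} (R : CommutativeRing c ℓ) where
  open CommutativeRing R

  pow : Carrier → ℕ → Carrier
  pow a zero    = 1#
  pow a (suc k) = a * pow a k

  sumBelow : ℕ → (ℕ → Carrier) → Carrier
  sumBelow zero    f = 0#
  sumBelow (suc n) f = sumBelow n f + f n

  prodBelow : ℕ → (ℕ → Carrier) → Carrier
  prodBelow zero    f = 1#
  prodBelow (suc n) f = prodBelow n f * f n

  qint : Carrier → ℕ → Carrier
  qint q m = sumBelow m (pow q)

  qfact : Carrier → ℕ → Carrier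
  qfact q m = prodBelow m (λ i → qint q (suc i))

  -- Gaussian binomial [m choose j] = [m]! / ([j]! [m-j]!),
  -- where inv j denotes the inverse of [j]! (supplied as data together
  -- with a proof that it is an inverse, see the theorem statement).
  qbinom : Carrier → (ℕ → Carrier) → ℕ → ℕ → Carrier
  qbinom q inv m j = qfact q m * (inv j * inv (m ∸ j))

  -- Π_{j = top+1-k}^{top} (1 + q^j)  =  Π_{i=0}^{k-1} (1 + q^(top - i))
  -- (used only with k ≤ top, so no truncated subtraction occurs)
  prodTop : Carrier → ℕ → ℕ → Carrier
  prodTop q top k = prodBelow k (λ i → 1# + pow q (top ∸ i))

  -- Ush q x s n = U_{n-1}(x,s,q), i.e. the paper's sequence shifted by one
  -- so that U_{-1} = 0 can be indexed by a natural number: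
  --   U_{-1} = 0, U_0 = 1,
  --   U_p = (1 + q^p) x U_{p-1} + q^(p-1) s U_{p-2}   (p ≥ 1).
  Ush : Carrier → Carrier → Carrier → ℕ → Carrier
  Ush q x s zero                = 0#
  Ush q x s (suc zero)          = 1#
  Ush q x s (suc (suc p)) =
    (1# + pow q (suc p)) * x * Ush q x s (suc p) + pow q p * s * Ush q x s p

-- Write L(n,m) and R(n,m) for the two sides. Both satisfy
--   X(n+1,m) + q^n (1 + q^(m+1)) X(n,m+1) = X(n,m+2),   X(0,m) = U_(m-1),
-- which determines X. For R this is the defining recurrence of U. For L,
-- compare the sums term by term after a shift of k by one: by the two
-- q-Pascal rules the Gaussian coefficients satisfy
--   q^k [n+1,k+1] (1 + q^(n+m+1-k)) = q^k [n,k+1] (1 + q^(n+m+2)) + q^n (1 + q^(m+1)) [n,k],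
-- and the last term is cancelled because [n+1,n+1] = [n,n] = 1.
module Submission where

open import Defs
open import Level using (Level)
open import Data.Nat as ℕ using (ℕ; zero; suc; _∸_)
open import Data.Nat.Combinatorics using (_C_; nC1≡n; nCk+nC[k+1]≡[n+1]C[k+1])
import Data.Nat.Properties as ℕₚ
open import Data.Nat.Tactic.RingSolver using (solve-∀)
open import Data.Product using (_,_)
open import Algebra.Bundles using (CommutativeRing)
import Algebra.Properties.Group as GroupProperties
import Algebra.Solver.Ring.NaturalCoefficients.Default as NaturalCoefficients
open import Relation.Nullary using (¬_)
open import Relation.Binary.PropositionalEquality as ≡ using (_≡_)

suc-C-2 : ∀ k → suc k C 2 ≡ k ℕ.+ k C 2
suc-C-2 k = ≡.trans (≡.sym (nCk+nC[k+1]≡[n+1]C[k+1] k 1)) (≡.cong (ℕ._+ k C 2) (nC1≡n k))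

suc-+-∸ : ∀ k x → suc (k ℕ.+ x) ∸ k ≡ suc x
suc-+-∸ k x = ≡.trans (≡.cong (_∸ k) (≡.sym (ℕₚ.+-suc k x))) (ℕₚ.m+n∸m≡n k (suc x))

suc-suc-+ : ∀ k b → suc (suc (k ℕ.+ b)) ≡ suc k ℕ.+ suc b
suc-suc-+ k b = ≡.cong suc (≡.sym (ℕₚ.+-suc k b))

+-suc-suc : ∀ a m → a ℕ.+ suc (suc m) ≡ suc (suc (a ℕ.+ m))
+-suc-suc a m = ≡.trans (ℕₚ.+-suc a (suc m)) (≡.cong suc (ℕₚ.+-suc a m))

2*-suc-+ : ∀ n m → 2 ℕ.* suc n ℕ.+ m ≡ suc (suc (2 ℕ.* n ℕ.+ m))
2*-suc-+ = solve-∀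

exponent : ℕ → ℕ → ℕ
exponent n m = (n ℕ.* n ∸ n) ℕ.+ m ℕ.* n

exponent-suc-closed : ∀ n m → exponent (suc n) m ≡ n ℕ.* suc n ℕ.+ m ℕ.* suc n
exponent-suc-closed n m = ≡.cong (ℕ._+ m ℕ.* suc n) (ℕₚ.m+n∸m≡n (suc n) (n ℕ.* suc n))

exponent-suc-sucʳ : ∀ n m → exponent n (suc (suc m)) ≡ n ℕ.+ exponent n (suc m)
exponent-suc-sucʳ n m = shuffle (n ℕ.* n ∸ n) n (m ℕ.* n)
  where
  shuffle : ∀ t n x → t ℕ.+ (n ℕ.+ (n ℕ.+ x)) ≡ n ℕ.+ (t ℕ.+ (n ℕ.+ x))
  shuffle = solve-∀

exponent-sucˡ : ∀ n m → exponent (suc n) m ≡ n ℕ.+ exponent n (suc m) ℕ.+ m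
exponent-sucˡ zero m = ≡.trans (exponent-suc-closed 0 m) (base m)
  where
  base : ∀ m → m ℕ.* 1 ≡ m ℕ.* 0 ℕ.+ m
  base = solve-∀
exponent-sucˡ (suc n) m = begin
  exponent (suc (suc n)) m                               ≡⟨ exponent-suc-closed (suc n) m ⟩
  suc n ℕ.* suc (suc n) ℕ.+ m ℕ.* suc (suc n)            ≡⟨ expand n m ⟩
  suc n ℕ.+ (n ℕ.* suc n ℕ.+ suc m ℕ.* suc n) ℕ.+ m      ≡⟨ ≡.cong (λ e → suc n ℕ.+ e ℕ.+ m)
                                                              (≡.sym (exponent-suc-closed n (suc m))) ⟩
  suc n ℕ.+ exponent (suc n) (suc m) ℕ.+ m               ∎
  where
  open ≡.≡-Reasoning
  expand : ∀ n m → suc n ℕ.* suc (suc n) ℕ.+ m ℕ.* suc (suc n)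
                   ≡ suc n ℕ.+ (n ℕ.* suc n ℕ.+ suc m ℕ.* suc n) ℕ.+ m
  expand = solve-∀

module QIdentities {c ℓ : Level} (R : CommutativeRing c ℓ) where
  open CommutativeRing R
  open Q R
  open import Relation.Binary.Reasoning.Setoid setoid
  open GroupProperties +-group using (∙-cancelʳ)
  open NaturalCoefficients commutativeSemiring using (solve; _:+_; _:*_; _:=_; con)

  pow-+ : ∀ a i j → pow a (i ℕ.+ j) ≈ pow a i * pow a j
  pow-+ a zero    j = sym (*-identityˡ _)
  pow-+ a (suc i) j = trans (*-congˡ (pow-+ a i j)) (sym (*-assoc _ _ _))

  pow-neg-one-suc : ∀ k → pow (- 1#) (suc k) + pow (- 1#) k ≈ 0#
  pow-neg-one-suc k = begin
    - 1# * σ + σ      ≈⟨ solve 2 (λ x σ → x :* σ :+ σ := (x :+ con 1) :* σ) refl (- 1#) σ ⟩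
    (- 1# + 1#) * σ   ≈⟨ *-congʳ (-‿inverseˡ 1#) ⟩
    0# * σ            ≈⟨ zeroˡ σ ⟩
    0#                ∎
    where σ = pow (- 1#) k

  opposite-cancel : ∀ a b β δ l G → a + b ≈ 0# →
                    a * (β + l * δ) * G + l * (b * δ * G) ≈ a * β * G
  opposite-cancel a b β δ l G a+b≈0 = begin
    a * (β + l * δ) * G + l * (b * δ * G)
      ≈⟨ solve 6 (λ a b β δ l G → a :* (β :+ l :* δ) :* G :+ l :* (b :* δ :* G)
                                  := a :* β :* G :+ (a :+ b) :* (l :* δ :* G))
               refl a b β δ l G ⟩
    a * β * G + (a + b) * (l * δ * G)   ≈⟨ +-congˡ (*-congʳ a+b≈0) ⟩
    a * β * G + 0# * (l * δ * G)        ≈⟨ +-congˡ (zeroˡ _) ⟩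
    a * β * G + 0#                      ≈⟨ +-identityʳ _ ⟩
    a * β * G                           ∎

  qint-+ : ∀ q i j → qint q (i ℕ.+ j) ≈ qint q i + pow q i * qint q j
  qint-+ q i zero = begin
    qint q (i ℕ.+ 0)          ≈⟨ reflexive (≡.cong (qint q) (ℕₚ.+-identityʳ i)) ⟩
    qint q i                  ≈⟨ sym (+-identityʳ _) ⟩
    qint q i + 0#             ≈⟨ +-congˡ (sym (zeroʳ _)) ⟩
    qint q i + pow q i * 0#   ∎
  qint-+ q i (suc j) = begin
    qint q (i ℕ.+ suc j)
      ≈⟨ reflexive (≡.cong (qint q) (ℕₚ.+-suc i j)) ⟩
    qint q (i ℕ.+ j) + pow q (i ℕ.+ j)
      ≈⟨ +-cong (qint-+ q i j) (pow-+ q i j) ⟩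
    qint q i + pow q i * qint q j + pow q i * pow q j
      ≈⟨ solve 4 (λ a x b c → a :+ x :* b :+ x :* c := a :+ x :* (b :+ c))
               refl (qint q i) (pow q i) (qint q j) (pow q j) ⟩
    qint q i + pow q i * (qint q j + pow q j)
      ∎

  prodTop-suc : ∀ q T k → prodTop q (suc T) (suc k) ≈ (1# + pow q (suc T)) * prodTop q T k
  prodTop-suc q T zero    = trans (*-identityˡ _) (sym (*-identityʳ _))
  prodTop-suc q T (suc k) = trans (*-congʳ (prodTop-suc q T k)) (*-assoc _ _ _)

  sumBelow-merge : ∀ n (f g h : ℕ → Carrier) l → f 0 ≈ h 0 →
                   (∀ k → k ℕ.< n → f (suc k) + l * g k ≈ h (suc k)) →
                   sumBelow (suc n) f + l * sumBelow n g ≈ sumBelow (suc n) h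
  sumBelow-merge zero f g h l f0≈h0 _ = begin
    0# + f 0 + l * 0#   ≈⟨ +-cong (+-congˡ f0≈h0) (zeroʳ l) ⟩
    0# + h 0 + 0#       ≈⟨ +-identityʳ _ ⟩
    0# + h 0            ∎
  sumBelow-merge (suc n) f g h l f0≈h0 step = begin
    sumBelow (suc n) f + f (suc n) + l * (sumBelow n g + g n)
      ≈⟨ solve 5 (λ a b l c d → a :+ b :+ l :* (c :+ d) := (a :+ l :* c) :+ (b :+ l :* d))
               refl (sumBelow (suc n) f) (f (suc n)) l (sumBelow n g) (g n) ⟩
    (sumBelow (suc n) f + l * sumBelow n g) + (f (suc n) + l * g n)
      ≈⟨ +-cong (sumBelow-merge n f g h l f0≈h0 (λ k k<n → step k (ℕₚ.m<n⇒m<1+n k<n)))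
                (step n (ℕₚ.n<1+n n)) ⟩
    sumBelow (suc n) h + h (suc n)
      ∎

  sumBelow-merge-last : ∀ n (f g h : ℕ → Carrier) l → f 0 ≈ h 0 →
                        (∀ k → k ℕ.< n → f (suc k) + l * g k ≈ h (suc k)) →
                        f (suc n) + l * g n ≈ 0# →
                        sumBelow (suc (suc n)) f + l * sumBelow (suc n) g ≈ sumBelow (suc n) h
  sumBelow-merge-last n f g h l f0≈h0 step last = begin
    sumBelow (suc n) f + f (suc n) + l * (sumBelow n g + g n)
      ≈⟨ solve 5 (λ a b l c d → a :+ b :+ l :* (c :+ d) := (a :+ l :* c) :+ (b :+ l :* d))
               refl (sumBelow (suc n) f) (f (suc n)) l (sumBelow n g) (g n) ⟩
    (sumBelow (suc n) f + l * sumBelow n g) + (f (suc n) + l * g n)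
      ≈⟨ +-cong (sumBelow-merge n f g h l f0≈h0 step) last ⟩
    sumBelow (suc n) h + 0#
      ≈⟨ +-identityʳ _ ⟩
    sumBelow (suc n) h
      ∎

  determined-by-recurrence :
    (X Y κ : ℕ → ℕ → Carrier) → (∀ m → X 0 m ≈ Y 0 m) →
    (∀ n m → X (suc n) m + κ n m * X n (suc m) ≈ X n (suc (suc m))) →
    (∀ n m → Y (suc n) m + κ n m * Y n (suc m) ≈ Y n (suc (suc m))) →
    ∀ n m → X n m ≈ Y n m
  determined-by-recurrence X Y κ base recX recY zero m = base m
  determined-by-recurrence X Y κ base recX recY (suc n) m =
    ∙-cancelʳ (κ n m * Y n (suc m)) (X (suc n) m) (Y (suc n) m) (begin
      X (suc n) m + κ n m * Y n (suc m)   ≈⟨ +-congˡ (*-congˡ (sym (X≈Y (suc m)))) ⟩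
      X (suc n) m + κ n m * X n (suc m)   ≈⟨ recX n m ⟩
      X n (suc (suc m))                   ≈⟨ X≈Y (suc (suc m)) ⟩
      Y n (suc (suc m))                   ≈⟨ sym (recY n m) ⟩
      Y (suc n) m + κ n m * Y n (suc m)   ∎)
    where
    X≈Y : ∀ m → X n m ≈ Y n m
    X≈Y = determined-by-recurrence X Y κ base recX recY n

  module GaussianBinomial (q : Carrier) (inv : ℕ → Carrier)
                          (inv-qfact : ∀ j → inv j * qfact q j ≈ 1#) where

    inv-zero : inv 0 ≈ 1#
    inv-zero = trans (sym (*-identityʳ _)) (inv-qfact 0)

    inv-suc : ∀ j → inv j ≈ inv (suc j) * qint q (suc j)
    inv-suc j = begin
      inv j                                                   ≈⟨ sym (*-identityʳ _) ⟩
      inv j * 1#                                              ≈⟨ *-congˡ (sym (inv-qfact (suc j))) ⟩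
      inv j * (inv (suc j) * (qfact q j * qint q (suc j)))
        ≈⟨ solve 4 (λ a b c d → a :* (b :* (c :* d)) := (a :* c) :* (b :* d))
                 refl (inv j) (inv (suc j)) (qfact q j) (qint q (suc j)) ⟩
      inv j * qfact q j * (inv (suc j) * qint q (suc j))     ≈⟨ *-congʳ (inv-qfact j) ⟩
      1# * (inv (suc j) * qint q (suc j))                     ≈⟨ *-identityˡ _ ⟩
      inv (suc j) * qint q (suc j)                            ∎

    qfact-inv : ∀ n → qfact q n * inv n ≈ 1#
    qfact-inv n = trans (*-comm _ _) (inv-qfact n)

    qbinom-zero : ∀ n → qbinom q inv n 0 ≈ 1#
    qbinom-zero n = trans (*-congˡ (trans (*-congʳ inv-zero) (*-identityˡ _))) (qfact-inv n)

    qbinom-diag : ∀ n → qbinom q inv n n ≈ 1#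
    qbinom-diag n = trans (*-congˡ (trans (*-congˡ inv-n∸n) (*-identityʳ _))) (qfact-inv n)
      where
      inv-n∸n : inv (n ∸ n) ≈ 1#
      inv-n∸n = trans (reflexive (≡.cong inv (ℕₚ.n∸n≡0 n))) inv-zero

    module _ (k b : ℕ) where
      common : Carrier
      common = qfact q (suc (k ℕ.+ b)) * (inv (suc k) * inv (suc b))

      qbinom-lower : qbinom q inv (suc (k ℕ.+ b)) k ≈ common * qint q (suc k)
      qbinom-lower = begin
        qfact q n * (inv k * inv (n ∸ k))
          ≈⟨ *-congˡ (*-cong (inv-suc k) (reflexive (≡.cong inv (suc-+-∸ k b)))) ⟩
        qfact q n * (inv (suc k) * qint q (suc k) * inv (suc b))
          ≈⟨ solve 4 (λ f i K j → f :* (i :* K :* j) := f :* (i :* j) :* K)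
                   refl (qfact q n) (inv (suc k)) (qint q (suc k)) (inv (suc b)) ⟩
        common * qint q (suc k)
          ∎
        where n = suc (k ℕ.+ b)

      qbinom-upper : qbinom q inv (suc (k ℕ.+ b)) (suc k) ≈ common * qint q (suc b)
      qbinom-upper = begin
        qfact q n * (inv (suc k) * inv (k ℕ.+ b ∸ k))
          ≈⟨ *-congˡ (*-congˡ (trans (reflexive (≡.cong inv (ℕₚ.m+n∸m≡n k b))) (inv-suc b))) ⟩
        qfact q n * (inv (suc k) * (inv (suc b) * qint q (suc b)))
          ≈⟨ solve 4 (λ f i j B → f :* (i :* (j :* B)) := f :* (i :* j) :* B)
                   refl (qfact q n) (inv (suc k)) (inv (suc b)) (qint q (suc b)) ⟩
        common * qint q (suc b)
          ∎
        where n = suc (k ℕ.+ b)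

      qbinom-next : qbinom q inv (suc (suc (k ℕ.+ b))) (suc k) ≈ common * qint q (suc (suc (k ℕ.+ b)))
      qbinom-next = begin
        qfact q n * qint q (suc n) * (inv (suc k) * inv (n ∸ k))
          ≈⟨ *-congˡ (*-congˡ (reflexive (≡.cong inv (suc-+-∸ k b)))) ⟩
        qfact q n * qint q (suc n) * (inv (suc k) * inv (suc b))
          ≈⟨ solve 4 (λ f E i j → f :* E :* (i :* j) := f :* (i :* j) :* E)
                   refl (qfact q n) (qint q (suc n)) (inv (suc k)) (inv (suc b)) ⟩
        common * qint q (suc n)
          ∎
        where n = suc (k ℕ.+ b)

      qint-split : qint q (suc (suc (k ℕ.+ b))) ≈ qint q (suc k) + pow q (suc k) * qint q (suc b)
      qint-split = trans (reflexive (≡.cong (qint q) (suc-suc-+ k b))) (qint-+ q (suc k) (suc b))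

      qint-split′ : qint q (suc (suc (k ℕ.+ b))) ≈ qint q (suc b) + pow q (suc b) * qint q (suc k)
      qint-split′ = trans (reflexive (≡.cong (qint q) (≡.trans (suc-suc-+ k b) (ℕₚ.+-comm (suc k) (suc b)))))
                          (qint-+ q (suc b) (suc k))

    qbinom-pascal : ∀ {n k} → k ℕ.< n →
      qbinom q inv (suc n) (suc k) ≈ qbinom q inv n k + pow q (suc k) * qbinom q inv n (suc k)
    qbinom-pascal {k = k} k<n with ℕₚ.m≤n⇒∃[o]m+o≡n k<n
    ... | b , ≡.refl = begin
      qbinom q inv (suc (suc (k ℕ.+ b))) (suc k)        ≈⟨ qbinom-next k b ⟩
      common k b * qint q (suc (suc (k ℕ.+ b)))         ≈⟨ *-congˡ (qint-split k b) ⟩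
      common k b * (qint q (suc k) + pow q (suc k) * qint q (suc b))
        ≈⟨ solve 4 (λ c x p y → c :* (x :+ p :* y) := c :* x :+ p :* (c :* y))
                 refl (common k b) (qint q (suc k)) (pow q (suc k)) (qint q (suc b)) ⟩
      common k b * qint q (suc k) + pow q (suc k) * (common k b * qint q (suc b))
        ≈⟨ sym (+-cong (qbinom-lower k b) (*-congˡ (qbinom-upper k b))) ⟩
      qbinom q inv (suc (k ℕ.+ b)) k + pow q (suc k) * qbinom q inv (suc (k ℕ.+ b)) (suc k)
        ∎

    qbinom-pascal′ : ∀ {n k} → k ℕ.< n →
      qbinom q inv (suc n) (suc k) ≈ pow q (n ∸ k) * qbinom q inv n k + qbinom q inv n (suc k)
    qbinom-pascal′ {k = k} k<n with ℕₚ.m≤n⇒∃[o]m+o≡n k<n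
    ... | b , ≡.refl = begin
      qbinom q inv (suc (suc (k ℕ.+ b))) (suc k)        ≈⟨ qbinom-next k b ⟩
      common k b * qint q (suc (suc (k ℕ.+ b)))         ≈⟨ *-congˡ (qint-split′ k b) ⟩
      common k b * (qint q (suc b) + pow q (suc b) * qint q (suc k))
        ≈⟨ solve 4 (λ c y p x → c :* (y :+ p :* x) := p :* (c :* x) :+ c :* y)
                 refl (common k b) (qint q (suc b)) (pow q (suc b)) (qint q (suc k)) ⟩
      pow q (suc b) * (common k b * qint q (suc k)) + common k b * qint q (suc b)
        ≈⟨ sym (+-cong (*-cong (reflexive (≡.cong (pow q) (suc-+-∸ k b))) (qbinom-lower k b))
                       (qbinom-upper k b)) ⟩
      pow q (suc (k ℕ.+ b) ∸ k) * qbinom q inv (suc (k ℕ.+ b)) k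
        + qbinom q inv (suc (k ℕ.+ b)) (suc k)
        ∎

  module Summands (q s : Carrier) where

    U : ℕ → Carrier
    U = Ush q 1# s

    κ : ℕ → ℕ → Carrier
    κ n m = pow q n * (1# + pow q (suc m))

    summand : ℕ → ℕ → Carrier → ℕ → Carrier
    summand T D B k = pow (- 1#) k * pow q (k C 2) * B * prodTop q T k * U (D ∸ k)

    weight : ℕ → ℕ → ℕ → Carrier
    weight T D k = pow q (k C 2) * prodTop q T k * U (D ∸ k)

    summand-0# : ∀ T D k → summand T D 0# k ≈ 0#
    summand-0# T D k = trans (*-congʳ (*-congʳ (zeroʳ _))) (trans (*-congʳ (zeroˡ _)) (zeroˡ _))

    summand-cong : ∀ T D {B B′} k → B ≈ B′ → summand T D B k ≈ summand T D B′ k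
    summand-cong T D k B≈B′ = *-congʳ (*-congʳ (*-congˡ B≈B′))

    summand-weight : ∀ T D B k → summand T D B k ≈ pow (- 1#) k * B * weight T D k
    summand-weight T D B k =
      solve 5 (λ σ c B P u → σ :* c :* B :* P :* u := σ :* B :* (c :* P :* u))
            refl (pow (- 1#) k) (pow q (k C 2)) B (prodTop q T k) (U (D ∸ k))

    summands-reindex : ∀ N (B : ℕ → Carrier) {T T′ D D′} → T ≡ T′ → D ≡ D′ →
      sumBelow N (λ k → summand T D (B k) k) ≈ sumBelow N (λ k → summand T′ D′ (B k) k)
    summands-reindex N B ≡.refl ≡.refl = refl

    pow-suc-C-2 : ∀ k → pow q (suc k C 2) ≈ pow q k * pow q (k C 2)
    pow-suc-C-2 k = trans (reflexive (≡.cong (pow q) (suc-C-2 k))) (pow-+ q k (k C 2))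

    summand-suc : ∀ T D B k →
      summand T (suc D) B (suc k)
        ≈ pow (- 1#) (suc k) * (pow q k * B * (1# + pow q (T ∸ k))) * weight T D k
    summand-suc T D B k = begin
      σ′ * pow q (suc k C 2) * B * (prodTop q T k * E) * U (D ∸ k)
        ≈⟨ *-congʳ (*-congʳ (*-congʳ (*-congˡ (pow-suc-C-2 k)))) ⟩
      σ′ * (pow q k * pow q (k C 2)) * B * (prodTop q T k * E) * U (D ∸ k)
        ≈⟨ solve 7 (λ σ′ x c B P E u → σ′ :* (x :* c) :* B :* (P :* E) :* u
                                       := σ′ :* (x :* B :* E) :* (c :* P :* u))
                 refl σ′ (pow q k) (pow q (k C 2)) B (prodTop q T k) E (U (D ∸ k)) ⟩
      σ′ * (pow q k * B * E) * weight T D k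
        ∎
      where
      σ′ = pow (- 1#) (suc k)
      E = 1# + pow q (T ∸ k)

    summand-suc-suc : ∀ T D B k →
      summand (suc T) (suc D) B (suc k)
        ≈ pow (- 1#) (suc k) * (pow q k * B * (1# + pow q (suc T))) * weight T D k
    summand-suc-suc T D B k = begin
      σ′ * pow q (suc k C 2) * B * prodTop q (suc T) (suc k) * U (D ∸ k)
        ≈⟨ *-congʳ (*-cong (*-congʳ (*-congˡ (pow-suc-C-2 k))) (prodTop-suc q T k)) ⟩
      σ′ * (pow q k * pow q (k C 2)) * B * (E * prodTop q T k) * U (D ∸ k)
        ≈⟨ solve 7 (λ σ′ x c B P E u → σ′ :* (x :* c) :* B :* (E :* P) :* u
                                       := σ′ :* (x :* B :* E) :* (c :* P :* u))
                 refl σ′ (pow q k) (pow q (k C 2)) B (prodTop q T k) E (U (D ∸ k)) ⟩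
      σ′ * (pow q k * B * E) * weight T D k
        ∎
      where
      σ′ = pow (- 1#) (suc k)
      E = 1# + pow q (suc T)

    -- Stated for any B₀ B₁ B₂ obeying the two q-Pascal rules so that it also
    -- covers the boundary term k = n with B₂ = 0: the encoded [n,n+1] is
    -- 1/[n+1], not 0.
    coefficient-identity : ∀ {n k} m {B₀ B₁ B₂} → k ℕ.≤ n →
      B₁ ≈ B₀ + pow q (suc k) * B₂ → B₁ ≈ pow q (n ∸ k) * B₀ + B₂ →
      pow q k * B₁ * (1# + pow q (suc (n ℕ.+ m) ∸ k))
        ≈ pow q k * B₂ * (1# + pow q (suc (suc (n ℕ.+ m)))) + κ n m * B₀
    coefficient-identity {k = k} m {B₀} {B₁} {B₂} k≤n pascal pascal′
      with ℕₚ.m≤n⇒∃[o]m+o≡n k≤n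
    ... | b , ≡.refl = begin
      X * B₁ * (1# + pow q (suc (k ℕ.+ b ℕ.+ m) ∸ k))
        ≈⟨ *-congˡ (+-congˡ lower-power) ⟩
      X * B₁ * (1# + q * (Y * Z))
        ≈⟨ solve 5 (λ X B₁ q Y Z → X :* B₁ :* (con 1 :+ q :* (Y :* Z))
                                   := X :* B₁ :+ q :* X :* Y :* Z :* B₁)
                 refl X B₁ q Y Z ⟩
      X * B₁ + q * X * Y * Z * B₁
        ≈⟨ +-cong (*-congˡ pascal′-at-b) (*-congˡ pascal) ⟩
      X * (Y * B₀ + B₂) + q * X * Y * Z * (B₀ + q * X * B₂)
        ≈⟨ solve 6 (λ X Y Z q B₀ B₂ →
                 X :* (Y :* B₀ :+ B₂) :+ q :* X :* Y :* Z :* (B₀ :+ q :* X :* B₂)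
                   := X :* B₂ :* (con 1 :+ q :* (q :* (X :* Y :* Z))) :+ X :* Y :* (con 1 :+ q :* Z) :* B₀)
                 refl X Y Z q B₀ B₂ ⟩
      X * B₂ * (1# + q * (q * (X * Y * Z))) + X * Y * (1# + q * Z) * B₀
        ≈⟨ sym (+-cong (*-congˡ (+-congˡ upper-power)) (*-congʳ (*-congʳ (pow-+ q k b)))) ⟩
      X * B₂ * (1# + pow q (suc (suc (k ℕ.+ b ℕ.+ m)))) + κ (k ℕ.+ b) m * B₀
        ∎
      where
      X = pow q k
      Y = pow q b
      Z = pow q m
      pascal′-at-b : B₁ ≈ Y * B₀ + B₂
      pascal′-at-b = trans pascal′ (+-congʳ (*-congʳ (reflexive (≡.cong (pow q) (ℕₚ.m+n∸m≡n k b)))))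
      lower-power : pow q (suc (k ℕ.+ b ℕ.+ m) ∸ k) ≈ q * (Y * Z)
      lower-power = trans (reflexive (≡.cong (pow q) (≡.trans (≡.cong (λ x → suc x ∸ k) (ℕₚ.+-assoc k b m))
                                                                (suc-+-∸ k (b ℕ.+ m)))))
                          (*-congˡ (pow-+ q b m))
      upper-power : pow q (suc (suc (k ℕ.+ b ℕ.+ m))) ≈ q * (q * (X * Y * Z))
      upper-power = *-congˡ (*-congˡ (trans (pow-+ q (k ℕ.+ b) m) (*-congʳ (pow-+ q k b))))

    term-recurrence : ∀ {n k} m D {B₀ B₁ B₂} → k ℕ.≤ n →
      B₁ ≈ B₀ + pow q (suc k) * B₂ → B₁ ≈ pow q (n ∸ k) * B₀ + B₂ →
      summand (suc (n ℕ.+ m)) (suc (suc D)) B₁ (suc k) + κ n m * summand (suc (n ℕ.+ m)) (suc D) B₀ k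
        ≈ summand (suc (suc (n ℕ.+ m))) (suc (suc D)) B₂ (suc k)
    term-recurrence {n} {k} m D {B₀} {B₁} {B₂} k≤n pascal pascal′ = begin
      summand T (suc (suc D)) B₁ (suc k) + κ n m * summand T (suc D) B₀ k
        ≈⟨ +-cong (summand-suc T (suc D) B₁ k) (*-congˡ (summand-weight T (suc D) B₀ k)) ⟩
      σ′ * (pow q k * B₁ * (1# + pow q (T ∸ k))) * W + κ n m * (σ * B₀ * W)
        ≈⟨ +-congʳ (*-congʳ (*-congˡ (coefficient-identity m k≤n pascal pascal′))) ⟩
      σ′ * (β + κ n m * B₀) * W + κ n m * (σ * B₀ * W)
        ≈⟨ opposite-cancel σ′ σ β B₀ (κ n m) W (pow-neg-one-suc k) ⟩
      σ′ * β * W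
        ≈⟨ sym (summand-suc-suc T (suc D) B₂ k) ⟩
      summand (suc T) (suc (suc D)) B₂ (suc k)
        ∎
      where
      T = suc (n ℕ.+ m)
      σ = pow (- 1#) k
      σ′ = pow (- 1#) (suc k)
      W = weight T (suc D) k
      β = pow q k * B₂ * (1# + pow q (suc T))

    rhs : ℕ → ℕ → Carrier
    rhs n m = pow q (exponent n m) * pow s n * U m

    rhs-zero : ∀ m → rhs 0 m ≈ U m
    rhs-zero m = begin
      pow q (m ℕ.* 0) * 1# * U m   ≈⟨ *-congʳ (*-congʳ (reflexive (≡.cong (pow q) (ℕₚ.*-zeroʳ m)))) ⟩
      1# * 1# * U m                ≈⟨ trans (*-congʳ (*-identityˡ 1#)) (*-identityˡ _) ⟩
      U m                          ∎

    rhs-recurrence : ∀ n m → rhs (suc n) m + κ n m * rhs n (suc m) ≈ rhs n (suc (suc m))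
    rhs-recurrence n m = begin
      pow q (exponent (suc n) m) * (s * sⁿ) * U m + κ n m * (Qₑ * sⁿ * U (suc m))
        ≈⟨ +-congʳ (*-congʳ (*-congʳ (trans (reflexive (≡.cong (pow q) (exponent-sucˡ n m)))
              (trans (pow-+ q (n ℕ.+ exponent n (suc m)) m) (*-congʳ (pow-+ q n (exponent n (suc m)))))))) ⟩
      qⁿ * Qₑ * qᵐ * (s * sⁿ) * U m + qⁿ * (1# + q * qᵐ) * (Qₑ * sⁿ * U (suc m))
        ≈⟨ solve 8 (λ qⁿ Qₑ qᵐ s sⁿ Uₘ Uₘ₊₁ q →
              qⁿ :* Qₑ :* qᵐ :* (s :* sⁿ) :* Uₘ :+ qⁿ :* (con 1 :+ q :* qᵐ) :* (Qₑ :* sⁿ :* Uₘ₊₁)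
                := qⁿ :* Qₑ :* sⁿ :* ((con 1 :+ q :* qᵐ) :* con 1 :* Uₘ₊₁ :+ qᵐ :* s :* Uₘ))
              refl qⁿ Qₑ qᵐ s sⁿ (U m) (U (suc m)) q ⟩
      qⁿ * Qₑ * sⁿ * U (suc (suc m))
        ≈⟨ *-congʳ (*-congʳ (sym (trans (reflexive (≡.cong (pow q) (exponent-suc-sucʳ n m)))
                                         (pow-+ q n (exponent n (suc m)))))) ⟩
      pow q (exponent n (suc (suc m))) * sⁿ * U (suc (suc m))
        ∎
      where
      sⁿ = pow s n
      qⁿ = pow q n
      qᵐ = pow q m
      Qₑ = pow q (exponent n (suc m))

  module LeftHandSide (q s : Carrier) (inv : ℕ → Carrier)
                      (inv-qfact : ∀ j → inv j * qfact q j ≈ 1#) where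
    open GaussianBinomial q inv inv-qfact
    open Summands q s

    lhs : ℕ → ℕ → Carrier
    lhs n m = sumBelow (suc n) (λ k → summand (n ℕ.+ m) (2 ℕ.* n ℕ.+ m) (qbinom q inv n k) k)

    lhs-zero : ∀ m → lhs 0 m ≈ U m
    lhs-zero m = begin
      0# + summand m m (qbinom q inv 0 0) 0   ≈⟨ +-identityˡ _ ⟩
      summand m m (qbinom q inv 0 0) 0        ≈⟨ summand-cong m m 0 (qbinom-zero 0) ⟩
      1# * 1# * 1# * 1# * U m                 ≈⟨ solve 1 (λ u → con 1 :* con 1 :* con 1 :* con 1 :* u := u)
                                                          refl (U m) ⟩
      U m                                     ∎

    lhs-recurrence : ∀ n m → lhs (suc n) m + κ n m * lhs n (suc m) ≈ lhs n (suc (suc m))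
    lhs-recurrence n m = begin
      lhs (suc n) m + κ n m * lhs n (suc m)
        ≈⟨ +-cong (summands-reindex (suc (suc n)) (qbinom q inv (suc n)) ≡.refl (2*-suc-+ n m))
                  (*-congˡ (summands-reindex (suc n) (qbinom q inv n)
                                             (ℕₚ.+-suc n m) (ℕₚ.+-suc (2 ℕ.* n) m))) ⟩
      sumBelow (suc (suc n)) f + κ n m * sumBelow (suc n) g
        ≈⟨ sumBelow-merge-last n f g h (κ n m) first middle last ⟩
      sumBelow (suc n) h
        ≈⟨ summands-reindex (suc n) (qbinom q inv n)
                            (≡.sym (+-suc-suc n m)) (≡.sym (+-suc-suc (2 ℕ.* n) m)) ⟩
      lhs n (suc (suc m))
        ∎
      where
      T = n ℕ.+ m
      D = 2 ℕ.* n ℕ.+ m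
      f g h : ℕ → Carrier
      f k = summand (suc T) (suc (suc D)) (qbinom q inv (suc n) k) k
      g k = summand (suc T) (suc D) (qbinom q inv n k) k
      h k = summand (suc (suc T)) (suc (suc D)) (qbinom q inv n k) k

      first : f 0 ≈ h 0
      first = summand-cong (suc T) (suc (suc D)) 0 (trans (qbinom-zero (suc n)) (sym (qbinom-zero n)))

      middle : ∀ k → k ℕ.< n → f (suc k) + κ n m * g k ≈ h (suc k)
      middle k k<n = term-recurrence {n} m D (ℕₚ.<⇒≤ k<n) (qbinom-pascal k<n) (qbinom-pascal′ k<n)

      last : f (suc n) + κ n m * g n ≈ 0#
      last = trans (term-recurrence {n} m D ℕₚ.≤-refl diag-pascal diag-pascal′)
                   (summand-0# (suc (suc T)) (suc (suc D)) (suc n))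
        where
        diag-pascal : qbinom q inv (suc n) (suc n) ≈ qbinom q inv n n + pow q (suc n) * 0#
        diag-pascal = begin
          qbinom q inv (suc n) (suc n)          ≈⟨ qbinom-diag (suc n) ⟩
          1#                                    ≈⟨ sym (qbinom-diag n) ⟩
          qbinom q inv n n                      ≈⟨ sym (+-identityʳ _) ⟩
          qbinom q inv n n + 0#                 ≈⟨ +-congˡ (sym (zeroʳ _)) ⟩
          qbinom q inv n n + pow q (suc n) * 0# ∎
        diag-pascal′ : qbinom q inv (suc n) (suc n) ≈ pow q (n ∸ n) * qbinom q inv n n + 0#
        diag-pascal′ = begin
          qbinom q inv (suc n) (suc n)            ≈⟨ qbinom-diag (suc n) ⟩
          1#                                      ≈⟨ sym (*-identityˡ 1#) ⟩
          1# * 1#                                 ≈⟨ sym (*-cong (reflexive (≡.cong (pow q) (ℕₚ.n∸n≡0 n)))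
                                                                 (qbinom-diag n)) ⟩
          pow q (n ∸ n) * qbinom q inv n n        ≈⟨ sym (+-identityʳ _) ⟩
          pow q (n ∸ n) * qbinom q inv n n + 0#   ∎

theorem3p4 : ∀ {c ℓ} (R : CommutativeRing c ℓ) →
    let open CommutativeRing R
        open Q R
    in (q s : Carrier) → ¬ (q ≈ - 1#) →
       (inv : ℕ → Carrier) → (∀ j → inv j * qfact q j ≈ 1#) →
       (n m : ℕ) →
       sumBelow (ℕ.suc n) (λ k →
           pow (- 1#) k * pow q (k C 2) * qbinom q inv n k
           * prodTop q (n ℕ.+ m) k
           * Ush q 1# s ((2 ℕ.* n ℕ.+ m) ∸ k))
         ≈ pow q ((n ℕ.* n ∸ n) ℕ.+ m ℕ.* n) * pow s n * Ush q 1# s m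
theorem3p4 R q s _ inv inv-qfact =
  determined-by-recurrence lhs rhs κ (λ m → trans (lhs-zero m) (sym (rhs-zero m)))
                           lhs-recurrence rhs-recurrence
  where
  open CommutativeRing R
  open QIdentities R
  open Summands q s
  open LeftHandSide q s inv inv-qfact
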